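{- Let $X$ be a set and $R\subseteq X\times X$ be collusive. Then the actual protection relation induced by $R$ is collusive.
   Context: For a binary relation $S$ on $X$, $S$ is collusive iff $\forall x,y,z,w\in X\,\big((xSy \wedge xSz \wedge wSy)\Rightarrow wSz\big)$. The actual protection relation induced by $R$ is the binary relation $P$ on $X$ defined by $xPz$ iff $(\exists y\in X.\ yRz)\wedge \forall y\in X\,(yRz\Rightarrow xRy)$. -}

module Defs where

open import Level using (Level; _⊔_)
open import Data.Product using (_×_; ∃-syntax)
open import Relation.Binary.Core using (Rel)

Collusive : ∀ {a ℓ} {X : Set a} → Rel X ℓ → Set (a ⊔ ℓ)
Collusive {X = X} S = ∀ (x y z w : X) → S x y → S x z → S w y → S w z

ActualProtection : ∀ {a ℓ} {X : Set a} → Rel X ℓ → Rel X (a ⊔ ℓ)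
ActualProtection {X = X} R x z = (∃[ y ] R y z) × (∀ (y : X) → R y z → R x y)

module Submission where

open import Defs
open import Relation.Binary.Core using (Rel)
open import Data.Product using (_,_)

-- A common R-predecessor u of y serves as the pivot: x R u and w R u, so every
-- y′ R z with x R y′ also satisfies w R y′ by collusiveness of R.
mainTheorem2 : ∀ {a ℓ} {X : Set a} (R : Rel X ℓ) → Collusive R → Collusive (ActualProtection R)
mainTheorem2 R collusive x y z w ((u , uRy) , xRpredsY) (zHasPred , xRpredsZ) (_ , wRpredsY) =
  zHasPred , λ y′ y′Rz → collusive x u y′ w (xRpredsY u uRy) (xRpredsZ y′ y′Rz) (wRpredsY u uRy)
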